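{- If $\lambda$ and $\mu$ are wide partitions, then $\lambda+\mu$ is wide.
   Context: For partitions $\alpha,\beta$ of the same integer, $\alpha\ge\beta$ (dominance) means $\sum_{k\le j}\alpha_k\ge\sum_{k\le j}\beta_k$ for all $j$; $\nu'$ is the conjugate of $\nu$. $\nu$ is a subpartition of $\lambda$ if the multiset of parts of $\nu$ is a submultiset of that of $\lambda$. $\lambda$ is wide if $\nu\ge\nu'$ for every subpartition $\nu$ of $\lambda$. $\lambda+\mu$ is the partition whose $i$th part is $\lambda_i+\mu_i$ (missing parts treated as $0$). -}

module Defs where

open import Data.Nat using (ℕ; zero; suc; _≥_; _<_; _≤?_)
open import Data.List using (List; []; _∷_; _++_; map; filter; length; take; upTo)
open import Data.Nat.ListAction using (sum)
open import Data.Product using (_×_)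
open import Data.List.Relation.Unary.All using (All)
open import Data.List.Relation.Unary.Linked using (Linked)
open import Data.List.Relation.Binary.Permutation.Propositional using (_↭_)
open import Data.Product using (∃)

IsPartition : List ℕ → Set
IsPartition xs = All (λ x → 0 < x) xs × Linked _≥_ xs

largest : List ℕ → ℕ
largest [] = 0
largest (x ∷ _) = x

conj : List ℕ → List ℕ
conj ν = map (λ j → length (filter (j ≤?_) ν)) (map suc (upTo (largest ν)))

-- dominance α ≥ β : all partial sums of α are ≥ those of β
-- (missing parts count as 0, so quantifying over all j ∈ ℕ is harmless)
_⊵_ : List ℕ → List ℕ → Set
α ⊵ β = ∀ (j : ℕ) → sum (take j α) ≥ sum (take j β)

Subpartition : List ℕ → List ℕ → Set
Subpartition ν λ′ = IsPartition ν × ∃ (λ ρ → (ν ++ ρ) ↭ λ′)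

Wide : List ℕ → Set
Wide λ′ = ∀ (ν : List ℕ) → Subpartition ν λ′ → ν ⊵ conj ν

_⊕_ : List ℕ → List ℕ → List ℕ
[] ⊕ ys = ys
(x ∷ xs) ⊕ [] = x ∷ xs
(x ∷ xs) ⊕ (y ∷ ys) = (x Data.Nat.+ y) ∷ (xs ⊕ ys)

{-# OPTIONS --safe #-}
-- For a decreasing ν, the j-th partial sum of ν' counts the cells of ν lying in its first
-- j columns, which is Σᵢ min(νᵢ, j); so ν ⊵ ν' says Σᵢ min(νᵢ, j) ≤ ν₁ + … + νⱼ for every j.
-- A subpartition ν of λ + μ picks a set of rows of λ + μ; picking the same rows of λ and
-- of μ gives subpartitions α and β with ν = α + β. Partial sums are additive in the rows
-- while min(a + b, j) ≤ min(a, j) + min(b, j), so the inequalities for α and β add up to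
-- the one for ν.
module Submission where

open import Defs
open import Algebra.Properties.CommutativeSemigroup using (interchange)
open import Data.Bool using (Bool; true; false)
open import Data.Empty using (⊥-elim)
open import Data.List using (List; []; _∷_; [_]; _++_; map; filter; length; take; upTo; applyUpTo)
open import Data.List.Membership.Propositional.Properties using (∈-++⁻; ∈-∃++)
open import Data.List.Properties using (map-∘; map-upTo; ++-assoc)
open import Data.List.Relation.Binary.Permutation.Propositional
  using (_↭_; ↭-refl; ↭-sym; ↭-trans; ↭-prep; ↭-reflexive; ↭⇒↭ₛ)
open import Data.List.Relation.Binary.Permutation.Propositional.Properties
  using (shift; drop-mid; ∈-resp-↭; ¬x∷xs↭[])
open import Data.List.Relation.Binary.Pointwise using (Pointwise-≡⇒≡)
open import Data.List.Relation.Unary.All using (All; []; _∷_)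
open import Data.List.Relation.Unary.AllPairs using (AllPairs; []; _∷_)
open import Data.List.Relation.Unary.Any using (here)
open import Data.List.Relation.Unary.Linked using (Linked; [-]; _∷_)
open import Data.List.Relation.Unary.Linked.Properties using (Linked⇒All; Linked⇒AllPairs; AllPairs⇒Linked)
open import Data.List.Relation.Unary.Sorted.TotalOrder.Properties using (↗↭↗⇒≋)
open import Data.Nat using (ℕ; zero; suc; _+_; _⊓_; _≤_; _≥_; _≤?_; _<ᵇ_)
open import Data.Nat.ListAction using (sum)
open import Data.Nat.Properties
open import Data.Product using (_×_; _,_; ∃; ∃₂)
open import Data.Sum using (inj₁; inj₂)
open import Function using (_∘_; _⇔_; mk⇔; Equivalence)
open import Relation.Binary using (Rel)
open import Relation.Binary.Properties.TotalOrder ≤-totalOrder using (≥-totalOrder; ≥-trans)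
open import Relation.Binary.PropositionalEquality using (_≡_; refl; sym; trans; cong; cong₂; module ≡-Reasoning)
open import Relation.Nullary using (does)
open import Relation.Unary using (Pred)

Decreasing : List ℕ → Set
Decreasing = Linked _≥_

-- the length of column k of the diagram of ν, with columns numbered from 0
columnLength : ℕ → List ℕ → ℕ
columnLength k ν = length (filter (suc k ≤?_) ν)

cappedSum : ℕ → List ℕ → ℕ
cappedSum j ν = sum (map (_⊓ j) ν)

applyUpTo-cong : ∀ {A : Set} {f g : ℕ → A} n → (∀ k → f k ≡ g k) → applyUpTo f n ≡ applyUpTo g n
applyUpTo-cong zero    f≗g = refl
applyUpTo-cong (suc n) f≗g = cong₂ _∷_ (f≗g 0) (applyUpTo-cong n (f≗g ∘ suc))

take-applyUpTo : ∀ {A : Set} (f : ℕ → A) j n → take j (applyUpTo f n) ≡ applyUpTo f (j ⊓ n)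
take-applyUpTo f zero    n       = refl
take-applyUpTo f (suc j) zero    = refl
take-applyUpTo f (suc j) (suc n) = cong (f 0 ∷_) (take-applyUpTo (f ∘ suc) j n)

sum-applyUpTo-+ : ∀ (f g : ℕ → ℕ) n →
                  sum (applyUpTo (λ k → f k + g k) n) ≡ sum (applyUpTo f n) + sum (applyUpTo g n)
sum-applyUpTo-+ f g zero    = refl
sum-applyUpTo-+ f g (suc n) =
  trans (cong (f 0 + g 0 +_) (sum-applyUpTo-+ (f ∘ suc) (g ∘ suc) n))
        (interchange +-commutativeSemigroup (f 0) (g 0) _ _)

columnLength-∷ : ∀ k x ν → columnLength k (x ∷ ν) ≡ columnLength k [ x ] + columnLength k ν
columnLength-∷ k x ν with does (suc k ≤? x)
... | true  = refl
... | false = refl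

columnLength-suc : ∀ k x → columnLength (suc k) [ suc x ] ≡ columnLength k [ x ]
columnLength-suc k x with k <ᵇ x
... | true  = refl
... | false = refl

sum-columnLength-[_] : ∀ x n → sum (applyUpTo (λ k → columnLength k [ x ]) n) ≡ x ⊓ n
sum-columnLength-[ x ]     zero    = sym (⊓-zeroʳ x)
sum-columnLength-[ zero ]  (suc n) = sum-columnLength-[ zero ] n
sum-columnLength-[ suc x ] (suc n) = cong suc (begin
  sum (applyUpTo (λ k → columnLength (suc k) [ suc x ]) n)
    ≡⟨ cong sum (applyUpTo-cong n (λ k → columnLength-suc k x)) ⟩
  sum (applyUpTo (λ k → columnLength k [ x ]) n)
    ≡⟨ sum-columnLength-[ x ] n ⟩
  x ⊓ n ∎)
  where open ≡-Reasoning

sum-columnLength : ∀ ν n → sum (applyUpTo (λ k → columnLength k ν) n) ≡ cappedSum n ν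
sum-columnLength []      n = sum-columnLength-[ 0 ] n
sum-columnLength (x ∷ ν) n = begin
  sum (applyUpTo (λ k → columnLength k (x ∷ ν)) n)
    ≡⟨ cong sum (applyUpTo-cong n (λ k → columnLength-∷ k x ν)) ⟩
  sum (applyUpTo (λ k → columnLength k [ x ] + columnLength k ν) n)
    ≡⟨ sum-applyUpTo-+ _ _ n ⟩
  sum (applyUpTo (λ k → columnLength k [ x ]) n) + sum (applyUpTo (λ k → columnLength k ν) n)
    ≡⟨ cong₂ _+_ (sum-columnLength-[ x ] n) (sum-columnLength ν n) ⟩
  x ⊓ n + cappedSum n ν ∎
  where open ≡-Reasoning

conj≡applyUpTo : ∀ ν → conj ν ≡ applyUpTo (λ k → columnLength k ν) (largest ν)
conj≡applyUpTo ν = trans (sym (map-∘ (upTo (largest ν)))) (map-upTo _ (largest ν))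

sum-take-conj : ∀ ν j → sum (take j (conj ν)) ≡ cappedSum (j ⊓ largest ν) ν
sum-take-conj ν j = begin
  sum (take j (conj ν))                   ≡⟨ cong (sum ∘ take j) (conj≡applyUpTo ν) ⟩
  sum (take j (applyUpTo column L))       ≡⟨ cong sum (take-applyUpTo column j L) ⟩
  sum (applyUpTo column (j ⊓ L))          ≡⟨ sum-columnLength ν (j ⊓ L) ⟩
  cappedSum (j ⊓ L) ν                     ∎
  where
  open ≡-Reasoning
  L = largest ν
  column = λ k → columnLength k ν

cappedSum-⊓ : ∀ {L} j ν → All (_≤ L) ν → cappedSum (j ⊓ L) ν ≡ cappedSum j ν
cappedSum-⊓         j []      []           = refl
cappedSum-⊓ {L = L} j (x ∷ ν) (x≤L ∷ ν≤L) = cong₂ _+_ capped (cappedSum-⊓ j ν ν≤L)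
  where
  capped : x ⊓ (j ⊓ L) ≡ x ⊓ j
  capped = begin
    x ⊓ (j ⊓ L) ≡⟨ cong (x ⊓_) (⊓-comm j L) ⟩
    x ⊓ (L ⊓ j) ≡⟨ sym (⊓-assoc x L j) ⟩
    x ⊓ L ⊓ j   ≡⟨ cong (_⊓ j) (m≤n⇒m⊓n≡m x≤L) ⟩
    x ⊓ j       ∎
    where open ≡-Reasoning

decreasing⇒≤largest : ∀ {ν} → Decreasing ν → All (_≤ largest ν) ν
decreasing⇒≤largest {[]}    _  = []
decreasing⇒≤largest {_ ∷ _} ν↘ = Linked⇒All ≥-trans ≤-refl ν↘

sum-take-conj-decreasing : ∀ {ν} → Decreasing ν → ∀ j → sum (take j (conj ν)) ≡ cappedSum j ν
sum-take-conj-decreasing {ν} ν↘ j =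
  trans (sum-take-conj ν j) (cappedSum-⊓ j ν (decreasing⇒≤largest ν↘))

⊵conj⇔cappedSum≤ : ∀ {ν} → Decreasing ν → ν ⊵ conj ν ⇔ (∀ j → cappedSum j ν ≤ sum (take j ν))
⊵conj⇔cappedSum≤ ν↘ = mk⇔
  (λ ν⊵ν′ j → ≤-trans (≤-reflexive (sym (sum-take-conj-decreasing ν↘ j))) (ν⊵ν′ j))
  (λ capped j → ≤-trans (≤-reflexive (sum-take-conj-decreasing ν↘ j)) (capped j))

module _ {A : Set} where

  select : List Bool → List A → List A
  select []          _        = []
  select (_ ∷ _)     []       = []
  select (true  ∷ m) (x ∷ xs) = x ∷ select m xs
  select (false ∷ m) (x ∷ xs) = select m xs

  reject : List Bool → List A → List A
  reject []          xs       = xs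
  reject (_ ∷ _)     []       = []
  reject (true  ∷ m) (x ∷ xs) = reject m xs
  reject (false ∷ m) (x ∷ xs) = x ∷ reject m xs

  select++reject↭ : ∀ m xs → select m xs ++ reject m xs ↭ xs
  select++reject↭ []          xs       = ↭-refl
  select++reject↭ (_ ∷ _)     []       = ↭-refl
  select++reject↭ (true  ∷ m) (x ∷ xs) = ↭-prep x (select++reject↭ m xs)
  select++reject↭ (false ∷ m) (x ∷ xs) =
    ↭-trans (shift x (select m xs) (reject m xs)) (↭-prep x (select++reject↭ m xs))

  select-All : ∀ {p} {P : Pred A p} m {xs} → All P xs → All P (select m xs)
  select-All []          _          = []
  select-All (_ ∷ _)     []         = []
  select-All (true  ∷ m) (px ∷ pxs) = px ∷ select-All m pxs
  select-All (false ∷ m) (px ∷ pxs) = select-All m pxs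

  select-AllPairs : ∀ {r} {R : Rel A r} m {xs} → AllPairs R xs → AllPairs R (select m xs)
  select-AllPairs []          _          = []
  select-AllPairs (_ ∷ _)     []         = []
  select-AllPairs (true  ∷ m) (rx ∷ rxs) = select-All m rx ∷ select-AllPairs m rxs
  select-AllPairs (false ∷ m) (rx ∷ rxs) = select-AllPairs m rxs

  ++↭⇒↭select : ∀ {ν ρ} xs → ν ++ ρ ↭ xs → ∃ λ m → ν ↭ select m xs
  ++↭⇒↭select {[]}    []       _ = [] , ↭-refl
  ++↭⇒↭select {_ ∷ _} []       p = ⊥-elim (¬x∷xs↭[] p)
  ++↭⇒↭select {ν} {ρ} (x ∷ xs) p with ∈-++⁻ ν (∈-resp-↭ (↭-sym p) (here refl))
  ... | inj₁ x∈ν with ν₁ , ν₂ , refl ← ∈-∃++ x∈ν =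
    let m , q = ++↭⇒↭select xs rest in true ∷ m , ↭-trans (shift x ν₁ ν₂) (↭-prep x q)
    where
    rest : (ν₁ ++ ν₂) ++ ρ ↭ xs
    rest = ↭-trans (↭-reflexive (++-assoc ν₁ ν₂ ρ))
             (drop-mid ν₁ [] (↭-trans (↭-reflexive (sym (++-assoc ν₁ (x ∷ ν₂) ρ))) p))
  ... | inj₂ x∈ρ with ρ₁ , ρ₂ , refl ← ∈-∃++ x∈ρ =
    let m , q = ++↭⇒↭select xs rest in false ∷ m , q
    where
    rest : ν ++ (ρ₁ ++ ρ₂) ↭ xs
    rest = ↭-trans (↭-reflexive (sym (++-assoc ν ρ₁ ρ₂)))
             (drop-mid (ν ++ ρ₁) [] (↭-trans (↭-reflexive (++-assoc ν ρ₁ (x ∷ ρ₂))) p))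

select-decreasing : ∀ m {xs} → Decreasing xs → Decreasing (select m xs)
select-decreasing m xs↘ = AllPairs⇒Linked (select-AllPairs m (Linked⇒AllPairs ≥-trans xs↘))

select-Subpartition : ∀ m {λ′} → IsPartition λ′ → Subpartition (select m λ′) λ′
select-Subpartition m {λ′} (λ⁺ , λ↘) =
  (select-All m λ⁺ , select-decreasing m λ↘) , reject m λ′ , select++reject↭ m λ′

decreasing-↭⇒≡ : ∀ {xs ys} → Decreasing xs → Decreasing ys → xs ↭ ys → xs ≡ ys
decreasing-↭⇒≡ xs↘ ys↘ xs↭ys = Pointwise-≡⇒≡ (↗↭↗⇒≋ ≥-totalOrder xs↘ ys↘ (↭⇒↭ₛ xs↭ys))

⊕-identityʳ : ∀ xs → xs ⊕ [] ≡ xs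
⊕-identityʳ []      = refl
⊕-identityʳ (_ ∷ _) = refl

select-⊕ : ∀ m xs ys → select m (xs ⊕ ys) ≡ select m xs ⊕ select m ys
select-⊕ []          _          _        = refl
select-⊕ (_ ∷ _)     []         _        = refl
select-⊕ m@(_ ∷ _)   xs@(_ ∷ _) []       = sym (⊕-identityʳ (select m xs))
select-⊕ (true  ∷ m) (x ∷ xs)   (y ∷ ys) = cong (x + y ∷_) (select-⊕ m xs ys)
select-⊕ (false ∷ m) (x ∷ xs)   (y ∷ ys) = select-⊕ m xs ys

⊕-decreasing : ∀ {xs ys} → Decreasing xs → Decreasing ys → Decreasing (xs ⊕ ys)
⊕-decreasing {[]}                 _            ys↘          = ys↘
⊕-decreasing {_ ∷ _} {[]}         xs↘          _            = xs↘
⊕-decreasing                      [-]          [-]          = [-]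
⊕-decreasing {x ∷ _} {y ∷ _}      [-]          (y≥y′ ∷ ys↘) = ≤-trans y≥y′ (m≤n+m y x) ∷ ys↘
⊕-decreasing {x ∷ _} {y ∷ _}      (x≥x′ ∷ xs↘) [-]          = ≤-trans x≥x′ (m≤m+n x y) ∷ xs↘
⊕-decreasing                      (x≥x′ ∷ xs↘) (y≥y′ ∷ ys↘) = +-mono-≤ x≥x′ y≥y′ ∷ ⊕-decreasing xs↘ ys↘

sum-take-⊕ : ∀ j xs ys → sum (take j (xs ⊕ ys)) ≡ sum (take j xs) + sum (take j ys)
sum-take-⊕ zero    _        _        = refl
sum-take-⊕ (suc j) []       _        = refl
sum-take-⊕ (suc j) (_ ∷ _)  []       = sym (+-identityʳ _)
sum-take-⊕ (suc j) (x ∷ xs) (y ∷ ys) =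
  trans (cong (x + y +_) (sum-take-⊕ j xs ys))
        (interchange +-commutativeSemigroup x y (sum (take j xs)) (sum (take j ys)))

+-⊓-subadditive : ∀ x y j → (x + y) ⊓ j ≤ x ⊓ j + y ⊓ j
+-⊓-subadditive x y j with ≤-total j x | ≤-total j y
... | inj₁ j≤x | _ rewrite m≥n⇒m⊓n≡n j≤x =
  ≤-trans (m⊓n≤n (x + y) j) (m≤m+n j (y ⊓ j))
... | inj₂ x≤j | inj₁ j≤y rewrite m≤n⇒m⊓n≡m x≤j | m≥n⇒m⊓n≡n j≤y =
  ≤-trans (m⊓n≤n (x + y) j) (m≤n+m j x)
... | inj₂ x≤j | inj₂ y≤j rewrite m≤n⇒m⊓n≡m x≤j | m≤n⇒m⊓n≡m y≤j =
  m⊓n≤m (x + y) j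

cappedSum-⊕ : ∀ j xs ys → cappedSum j (xs ⊕ ys) ≤ cappedSum j xs + cappedSum j ys
cappedSum-⊕ j []       ys       = ≤-refl
cappedSum-⊕ j (_ ∷ _)  []       = ≤-reflexive (sym (+-identityʳ _))
cappedSum-⊕ j (x ∷ xs) (y ∷ ys) = begin
  (x + y) ⊓ j + cappedSum j (xs ⊕ ys)
    ≤⟨ +-mono-≤ (+-⊓-subadditive x y j) (cappedSum-⊕ j xs ys) ⟩
  (x ⊓ j + y ⊓ j) + (cappedSum j xs + cappedSum j ys)
    ≡⟨ interchange +-commutativeSemigroup (x ⊓ j) (y ⊓ j) _ _ ⟩
  (x ⊓ j + cappedSum j xs) + (y ⊓ j + cappedSum j ys) ∎
  where open ≤-Reasoning

⊵conj-⊕ : ∀ {α β} → Decreasing α → Decreasing β →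
          α ⊵ conj α → β ⊵ conj β → (α ⊕ β) ⊵ conj (α ⊕ β)
⊵conj-⊕ {α} {β} α↘ β↘ α⊵α′ β⊵β′ =
  Equivalence.from (⊵conj⇔cappedSum≤ (⊕-decreasing α↘ β↘)) λ j → begin
    cappedSum j (α ⊕ β)             ≤⟨ cappedSum-⊕ j α β ⟩
    cappedSum j α + cappedSum j β   ≤⟨ +-mono-≤ (capped α↘ α⊵α′ j) (capped β↘ β⊵β′ j) ⟩
    sum (take j α) + sum (take j β) ≡⟨ sum-take-⊕ j α β ⟨
    sum (take j (α ⊕ β))            ∎
  where
  open ≤-Reasoning
  capped : ∀ {ν} → Decreasing ν → ν ⊵ conj ν → ∀ j → cappedSum j ν ≤ sum (take j ν)
  capped ν↘ = Equivalence.to (⊵conj⇔cappedSum≤ ν↘)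

Subpartition-⊕ : ∀ {λ′ μ ν} → IsPartition λ′ → IsPartition μ → Subpartition ν (λ′ ⊕ μ) →
                 ∃₂ λ α β → Subpartition α λ′ × Subpartition β μ × ν ≡ α ⊕ β
Subpartition-⊕ {λ′} {μ} {ν} λ-part@(_ , λ↘) μ-part@(_ , μ↘) ((_ , ν↘) , _ , ν++ρ↭λ⊕μ) =
  let m , ν↭ = ++↭⇒↭select (λ′ ⊕ μ) ν++ρ↭λ⊕μ in
  select m λ′ , select m μ , select-Subpartition m λ-part , select-Subpartition m μ-part ,
  (begin
    ν                  ≡⟨ decreasing-↭⇒≡ ν↘ (select-decreasing m (⊕-decreasing λ↘ μ↘)) ν↭ ⟩
    select m (λ′ ⊕ μ)  ≡⟨ select-⊕ m λ′ μ ⟩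
    select m λ′ ⊕ select m μ ∎)
  where open ≡-Reasoning

corollary1 : (λ′ μ : List ℕ) → IsPartition λ′ → IsPartition μ → Wide λ′ → Wide μ → Wide (λ′ ⊕ μ)
corollary1 λ′ μ λ-part μ-part λ-wide μ-wide ν ν-sub
  with α , β , α-sub@((_ , α↘) , _) , β-sub@((_ , β↘) , _) , refl ← Subpartition-⊕ λ-part μ-part ν-sub
  = ⊵conj-⊕ α↘ β↘ (λ-wide α α-sub) (μ-wide β β-sub)
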